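{- Let $(\mathbf{A},r,k)$ be a yes-instance of \textsc{Low GF(2)-Rank Approximation}. Then $\mathbf{A}$ has at most $2^r+k$ pairwise distinct columns and at most $2^r+k$ pairwise distinct rows.
   Context: For binary matrices of equal size, $\|\mathbf{A}-\mathbf{B}\|_F^2$ is the number of differing entries. \textsc{Low GF(2)-Rank Approximation}: the input is a binary $m\times n$ matrix $\mathbf{A}$, a positive integer $r$ and a nonnegative integer $k$; it is a yes-instance if there is a binary $m\times n$ matrix $\mathbf{B}$ of $\mathrm{GF}(2)$-rank at most $r$ with $\|\mathbf{A}-\mathbf{B}\|_F^2\le k$. -}

module Defs where

open import Data.Bool using (Bool; true; false; _xor_; _∧_; if_then_else_)
open import Data.Nat using (ℕ; zero; suc; _+_; _≤_)
open import Data.Fin using (Fin)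
open import Data.Product using (Σ; ∃; _×_; _,_)
open import Relation.Binary.PropositionalEquality using (_≡_; _≢_)
open import Relation.Nullary using (¬_)

-- GF(2) is represented by Bool: addition is xor, multiplication is ∧.

Matrix : ℕ → ℕ → Set
Matrix m n = Fin m → Fin n → Bool

sumGF2 : ∀ {r} → (Fin r → Bool) → Bool
sumGF2 {zero}  f = false
sumGF2 {suc r} f = f Fin.zero xor sumGF2 (λ l → f (Fin.suc l))

count : ∀ {n} → (Fin n → Bool) → ℕ
count {zero}  f = 0
count {suc n} f = (if f Fin.zero then 1 else 0) + count (λ i → f (Fin.suc i))

sumℕ : ∀ {n} → (Fin n → ℕ) → ℕ
sumℕ {zero}  f = 0
sumℕ {suc n} f = f Fin.zero + sumℕ (λ i → f (Fin.suc i))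

-- ‖A - B‖_F^2 : number of differing entries
distF : ∀ {m n} → Matrix m n → Matrix m n → ℕ
distF A B = sumℕ (λ i → count (λ j → A i j xor B i j))

-- GF(2)-rank of B is at most r: the column space of B is spanned by
-- r vectors u₀,…,u_{r-1} ∈ GF(2)^m, i.e. every column of B is a
-- GF(2)-linear combination  Σ_l c_{l j} u_l.
RankAtMost : ∀ {m n} → Matrix m n → ℕ → Set
RankAtMost {m} {n} B r =
  Σ (Fin r → Fin m → Bool) λ u →
  Σ (Fin r → Fin n → Bool) λ c →
    ∀ i j → B i j ≡ sumGF2 (λ l → u l i ∧ c l j)

YesInstance : ∀ {m n} → Matrix m n → ℕ → ℕ → Set
YesInstance {m} {n} A r k =
  Σ (Matrix m n) λ B → RankAtMost B r × (distF A B ≤ k)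

ColsDistinct : ∀ {m n} → Matrix m n → Fin n → Fin n → Set
ColsDistinct A j j' = ∃ λ i → A i j ≢ A i j'

RowsDistinct : ∀ {m n} → Matrix m n → Fin m → Fin m → Set
RowsDistinct A i i' = ∃ λ j → A i j ≢ A i' j

-- Let B be a rank-r factorisation U C of the approximating matrix. A row
-- of A that agrees with B is determined by its row of U, a vector in
-- GF(2)^r, so pairwise distinct agreeing rows number at most 2^r; every other
-- row contains a mismatch, so there are at most k of them. Columns are the
-- rows of the transpose, which is a yes-instance with the same r and k.
module Submission where

open import Defs
open import Data.Bool using (Bool; true; false; _xor_; _∧_; if_then_else_)
open import Data.Bool.Properties using (∧-comm)
open import Data.Fin
  using (Fin; zero; suc; _↑ˡ_; _↑ʳ_; splitAt; punchIn; punchOut; funToFin; finToFun; _≟_)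
open import Data.Fin.Properties
  using (0≢1+n; suc-injective; ↑ˡ-injective; ↑ʳ-injective; punchOut-injective;
         punchIn-punchOut; splitAt-↑ˡ; splitAt-↑ʳ; finToFun-funToFin; 2↔Bool)
open import Data.Nat using (ℕ; zero; suc; _+_; _^_; _≤_; z≤n; s≤s)
open import Data.Nat.Properties
  using (+-assoc; +-mono-≤; +-monoʳ-≤; +-0-commutativeMonoid; module ≤-Reasoning)
open import Algebra.Properties.CommutativeMonoid.Sum +-0-commutativeMonoid
  using (sum; sum-syntax; sum-remove; sum-cong-≗; ∑-comm)
open import Data.Product using (_×_; _,_; proj₁; proj₂)
open import Data.Sum using ([_,_]′)
open import Function using (_∘_; const; Injective; Injection; _↣_)
open import Function.Properties.Inverse using (↔⇒↣; ↔-sym)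
open import Relation.Binary.PropositionalEquality
  using (_≡_; _≢_; _≗_; refl; sym; trans; cong; cong₂; subst; module ≡-Reasoning)
open import Relation.Nullary using (yes; no; contradiction)

sumℕ≡sum : ∀ {n} (f : Fin n → ℕ) → sumℕ f ≡ sum f
sumℕ≡sum {zero}  f = refl
sumℕ≡sum {suc n} f = cong (f zero +_) (sumℕ≡sum (f ∘ suc))

count≡sum : ∀ {n} (p : Fin n → Bool) → count p ≡ sum (λ i → if p i then 1 else 0)
count≡sum {zero}  p = refl
count≡sum {suc n} p = cong ((if p zero then 1 else 0) +_) (count≡sum (p ∘ suc))

sum-ones : ∀ n → sum (λ (_ : Fin n) → 1) ≡ n
sum-ones zero    = refl
sum-ones (suc n) = cong suc (sum-ones n)

sum-↑ : ∀ R {N} (h : Fin (R + N) → ℕ) → sum h ≡ sum (h ∘ (_↑ˡ N)) + sum (h ∘ (R ↑ʳ_))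
sum-↑ zero    h = refl
sum-↑ (suc R) h = trans (cong (h zero +_) (sum-↑ R (h ∘ suc))) (sym (+-assoc (h zero) _ _))

injective⇒≤-sum : ∀ {t N} (φ : Fin t → Fin N) → Injective _≡_ _≡_ φ →
  (h : Fin N → ℕ) → (∀ a → 1 ≤ h (φ a)) → t ≤ sum h
injective⇒≤-sum {zero}          φ φ-inj h pos = z≤n
injective⇒≤-sum {suc t} {zero}  φ φ-inj h pos with () ← φ zero
injective⇒≤-sum {suc t} {suc N} φ φ-inj h pos = begin
  suc t                         ≤⟨ +-mono-≤ (pos zero) (injective⇒≤-sum φ′ φ′-inj h′ pos′) ⟩
  h (φ zero) + sum h′           ≡⟨ sym (sum-remove {i = φ zero} h) ⟩
  sum h                         ∎
  where
  open ≤-Reasoning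
  φ₀≢ : ∀ a → φ zero ≢ φ (suc a)
  φ₀≢ a = 0≢1+n ∘ φ-inj
  φ′ : Fin t → Fin N
  φ′ a = punchOut (φ₀≢ a)
  φ′-inj : Injective _≡_ _≡_ φ′
  φ′-inj {a} {b} e = suc-injective (φ-inj (punchOut-injective (φ₀≢ a) (φ₀≢ b) e))
  h′ : Fin N → ℕ
  h′ = h ∘ punchIn (φ zero)
  pos′ : ∀ a → 1 ≤ h′ (φ′ a)
  pos′ a = subst (λ x → 1 ≤ h x) (sym (punchIn-punchOut (φ₀≢ a))) (pos (suc a))

split-injective⇒≤ : ∀ {t R N} (idx : Fin t → Fin N) (key : Fin t → Fin R) (w : Fin N → ℕ) →
  Injective _≡_ _≡_ idx →
  (∀ {a b} → w (idx a) ≡ 0 → w (idx b) ≡ 0 → key a ≡ key b → a ≡ b) →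
  t ≤ R + sum w
split-injective⇒≤ {t} {R} {N} idx key w idx-inj key-inj = begin
  t                                               ≤⟨ injective⇒≤-sum φ φ-inj h h∘φ-pos ⟩
  sum h                                           ≡⟨ sum-↑ R h ⟩
  sum (h ∘ (_↑ˡ N)) + sum (h ∘ (R ↑ʳ_))           ≡⟨ cong₂ _+_ left right ⟩
  R + sum w                                       ∎
  where
  open ≤-Reasoning
  -- Zero-weight indices are sent through key into the first block, the others
  -- through idx into the second block, where h counts them with weight w ≥ 1.
  place : ℕ → Fin R → Fin N → Fin (R + N)
  place zero    k j = k ↑ˡ N
  place (suc _) k j = R ↑ʳ j
  φ : Fin t → Fin (R + N)
  φ a = place (w (idx a)) (key a) (idx a)
  h : Fin (R + N) → ℕ
  h = [ const 1 , w ]′ ∘ splitAt R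
  left : sum (h ∘ (_↑ˡ N)) ≡ R
  left = trans (sum-cong-≗ (λ k → cong [ const 1 , w ]′ (splitAt-↑ˡ R k N))) (sum-ones R)
  right : sum (h ∘ (R ↑ʳ_)) ≡ sum w
  right = sum-cong-≗ (λ j → cong [ const 1 , w ]′ (splitAt-↑ʳ R N j))
  ↑ˡ≢↑ʳ : ∀ k j → k ↑ˡ N ≢ R ↑ʳ j
  ↑ˡ≢↑ʳ k j e with () ← trans (sym (splitAt-↑ˡ R k N)) (trans (cong (splitAt R) e) (splitAt-↑ʳ R N j))
  φ-inj : Injective _≡_ _≡_ φ
  φ-inj {a} {b} e with w (idx a) in ea | w (idx b) in eb
  ... | zero  | zero  = key-inj ea eb (↑ˡ-injective N _ _ e)
  ... | suc _ | suc _ = idx-inj (↑ʳ-injective R _ _ e)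
  ... | zero  | suc _ = contradiction e (↑ˡ≢↑ʳ _ _)
  ... | suc _ | zero  = contradiction (sym e) (↑ˡ≢↑ʳ _ _)
  h∘φ-pos : ∀ a → 1 ≤ h (φ a)
  h∘φ-pos a with w (idx a) in ea
  ... | zero  rewrite splitAt-↑ˡ R (key a) N = s≤s z≤n
  ... | suc _ rewrite splitAt-↑ʳ R N (idx a) | ea = s≤s z≤n

count≡0⇒false : ∀ {n} (p : Fin n → Bool) → count p ≡ 0 → ∀ i → p i ≡ false
count≡0⇒false {suc n} p count≡0 i with p zero in p₀
count≡0⇒false p count≡0 zero    | false = p₀
count≡0⇒false p count≡0 (suc i) | false = count≡0⇒false (p ∘ suc) count≡0 i

xor≡false⇒≡ : ∀ {x y} → x xor y ≡ false → x ≡ y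
xor≡false⇒≡ {false} {false} _ = refl
xor≡false⇒≡ {true}  {true}  _ = refl
xor≡false⇒≡ {false} {true}  ()
xor≡false⇒≡ {true}  {false} ()

sumGF2-cong : ∀ {r} {f g : Fin r → Bool} → f ≗ g → sumGF2 f ≡ sumGF2 g
sumGF2-cong {zero}  f≗g = refl
sumGF2-cong {suc r} f≗g = cong₂ _xor_ (f≗g zero) (sumGF2-cong (f≗g ∘ suc))

bool↣fin2 : Bool ↣ Fin 2
bool↣fin2 = ↔⇒↣ (↔-sym 2↔Bool)

encode : ∀ {r} → (Fin r → Bool) → Fin (2 ^ r)
encode v = funToFin (Injection.to bool↣fin2 ∘ v)

encode-injective : ∀ {r} {v w : Fin r → Bool} → encode v ≡ encode w → v ≗ w
encode-injective {v = v} {w} e l = Injection.injective bool↣fin2 (begin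
  Injection.to bool↣fin2 (v l)                  ≡⟨ finToFun-funToFin _ l ⟨
  finToFun (encode v) l                         ≡⟨ cong (λ x → finToFun x l) e ⟩
  finToFun (encode w) l                         ≡⟨ finToFun-funToFin _ l ⟩
  Injection.to bool↣fin2 (w l)                  ∎)
  where open ≡-Reasoning

_ᵀ : ∀ {m n} → Matrix m n → Matrix n m
(A ᵀ) j i = A i j

RankAtMost-ᵀ : ∀ {m n} {B : Matrix m n} {r} → RankAtMost B r → RankAtMost (B ᵀ) r
RankAtMost-ᵀ (u , c , B≡uc) =
  c , u , λ j i → trans (B≡uc i j) (sumGF2-cong (λ l → ∧-comm (u l i) (c l j)))

distF≡∑∑ : ∀ {m n} (A B : Matrix m n) →
  distF A B ≡ ∑[ i < m ] ∑[ j < n ] (if A i j xor B i j then 1 else 0)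
distF≡∑∑ A B = trans (sumℕ≡sum (λ i → count (λ j → A i j xor B i j)))
                     (sum-cong-≗ (λ i → count≡sum (λ j → A i j xor B i j)))

distF-ᵀ : ∀ {m n} (A B : Matrix m n) → distF (A ᵀ) (B ᵀ) ≡ distF A B
distF-ᵀ A B = trans (distF≡∑∑ (A ᵀ) (B ᵀ))
  (trans (sym (∑-comm (λ i j → if A i j xor B i j then 1 else 0))) (sym (distF≡∑∑ A B)))

YesInstance-ᵀ : ∀ {m n} {A : Matrix m n} {r k} → YesInstance A r k → YesInstance (A ᵀ) r k
YesInstance-ᵀ {A = A} (B , rank≤r , dist≤k) =
  B ᵀ , RankAtMost-ᵀ rank≤r , subst (_≤ _) (sym (distF-ᵀ A B)) dist≤k

same-row⇒same-index : ∀ {m n t} (A : Matrix m n) (g : Fin t → Fin m) →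
  (∀ a b → a ≢ b → RowsDistinct A (g a) (g b)) →
  ∀ {a b} → (∀ j → A (g a) j ≡ A (g b) j) → a ≡ b
same-row⇒same-index A g distinct {a} {b} rows≡ with a ≟ b
... | yes a≡b = a≡b
... | no  a≢b = contradiction (rows≡ (proj₁ (distinct a b a≢b))) (proj₂ (distinct a b a≢b))

distinct-rows≤ : ∀ {m n} (A : Matrix m n) (r k : ℕ) → YesInstance A r k →
  ∀ t (g : Fin t → Fin m) → (∀ a b → a ≢ b → RowsDistinct A (g a) (g b)) → t ≤ 2 ^ r + k
distinct-rows≤ {m} A r k (B , (u , c , B≡uc) , dist≤k) t g distinct = begin
  t                           ≤⟨ split-injective⇒≤ g key mismatches g-inj key-inj ⟩
  2 ^ r + sum mismatches      ≡⟨ cong (2 ^ r +_) (sumℕ≡sum mismatches) ⟨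
  2 ^ r + distF A B           ≤⟨ +-monoʳ-≤ (2 ^ r) dist≤k ⟩
  2 ^ r + k                   ∎
  where
  open ≤-Reasoning
  mismatches : Fin m → ℕ
  mismatches i = count (λ j → A i j xor B i j)
  key : Fin t → Fin (2 ^ r)
  key a = encode (λ l → u l (g a))
  g-inj : Injective _≡_ _≡_ g
  g-inj e = same-row⇒same-index A g distinct (λ j → cong (λ i → A i j) e)
  agrees : ∀ {i} → mismatches i ≡ 0 → ∀ j → A i j ≡ B i j
  agrees none j = xor≡false⇒≡ (count≡0⇒false _ none j)
  B-rows≡ : ∀ {i i′} → (∀ l → u l i ≡ u l i′) → ∀ j → B i j ≡ B i′ j
  B-rows≡ {i} {i′} u≡ j =
    trans (B≡uc i j) (trans (sumGF2-cong (λ l → cong (_∧ c l j) (u≡ l))) (sym (B≡uc i′ j)))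
  key-inj : ∀ {a b} → mismatches (g a) ≡ 0 → mismatches (g b) ≡ 0 → key a ≡ key b → a ≡ b
  key-inj none-a none-b key≡ = same-row⇒same-index A g distinct (λ j →
    trans (agrees none-a j) (trans (B-rows≡ (encode-injective key≡) j) (sym (agrees none-b j))))

lemma6 : ∀ {m n} (A : Matrix m n) (r : ℕ) → 1 ≤ r → (k : ℕ) → YesInstance A r k →
    (∀ (t : ℕ) (f : Fin t → Fin n) → (∀ a b → a ≢ b → ColsDistinct A (f a) (f b)) → t ≤ 2 ^ r + k)
    × (∀ (t : ℕ) (g : Fin t → Fin m) → (∀ a b → a ≢ b → RowsDistinct A (g a) (g b)) → t ≤ 2 ^ r + k)
lemma6 A r _ k instance-A =
  distinct-rows≤ (A ᵀ) r k (YesInstance-ᵀ {A = A} instance-A) , distinct-rows≤ A r k instance-A
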